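{- Let ordinals below $\varepsilon_0$ be given and let step-down arguments be as defined in the context. (a) If $s\vdash\alpha\leq_k\beta$ and $k'\geq k$, then $s\vdash\alpha\leq_{k'}\beta$. (b) If $s$ is a step-down argument with top $\beta$ and bottom $\alpha$, then $\alpha\leq\beta$. (c) If $s$ is a step-down argument with top $\omega\cdot p+q$, bottom $\omega\cdot p'+q'$ (with $p,q,p',q'\in\mathbb N$) and base $\leq k$, then either $p'=p$ and $q'\leq q$, or else $p'<p$ and $q'\leq k+1$.
   Context: Ordinals below $\varepsilon_0$ are given in Cantor normal form. Fundamental sequences: $\{0\}(n)=0$, $\{\alpha+1\}(n)=\alpha$; for limit $\alpha=\gamma+\omega^{\delta}$ (Cantor normal form, $\delta>0$), $\{\alpha\}(n)=\gamma+\omega^{\delta'}\cdot(n+1)$ if $\delta=\delta'+1$, and $\{\alpha\}(n)=\gamma+\omega^{\{\delta\}(n)}$ if $\delta$ is a limit. An ordinal $\alpha$ meshes with $\gamma$ if $\alpha=0$ or $\gamma<\omega^{\alpha_0+1}$, where $\alpha_0$ is the smallest exponent in the Cantor normal form of $\alpha$. Step-down arguments are finite terms, each with a top and a bottom, generated by: (i) $\mathrm{fund}(m)$ with top $\beta$ and bottom $\{\beta\}(m)$ (any $\beta$, $m$); (ii) if $s$ has top $\beta$, bottom $\alpha$ and $t$ has top $\gamma$, bottom $\beta$, then $s*t$ has top $\gamma$, bottom $\alpha$; (iii) if $s$ has top $\gamma$, bottom $\beta$ and $\alpha$ meshes with $\gamma$, then $\alpha+s$ has top $\alpha+\gamma$,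 bottom $\alpha+\beta$; (iv) if $s$ has top $\beta$, bottom $\alpha$, then $\omega^s$ has top $\omega^\beta$, bottom $\omega^\alpha$. The base of $s$ is the maximal $m$ such that $\mathrm{fund}(m)$ occurs in $s$. $s\vdash\alpha\leq_k\beta$ means: top of $s$ is $\beta$, bottom is $\alpha$, base $\leq k$. -}

module Defs where

open import Data.Nat using (ℕ; zero; suc; _⊔_) renaming (_≤_ to _≤ℕ_)
open import Data.Bool using (Bool; true; false; if_then_else_)
open import Data.Unit using (⊤)
open import Data.Product using (_×_)
open import Data.Sum using (_⊎_)
open import Relation.Binary.PropositionalEquality using (_≡_)

-- Ordinal notations below ε₀ in Cantor normal form:
-- ω^ a + b  denotes  ω^a + b  (b's leading exponent ≤ a when in CNF).
data Ord : Set where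
  𝟎    : Ord
  ω^_+_ : Ord → Ord → Ord

data Cmp : Set where
  lt eq gt : Cmp

cmp : Ord → Ord → Cmp
cmp 𝟎 𝟎 = eq
cmp 𝟎 (ω^ _ + _) = lt
cmp (ω^ _ + _) 𝟎 = gt
cmp (ω^ a + b) (ω^ c + d) with cmp a c
... | lt = lt
... | gt = gt
... | eq = cmp b d

_<ₒ_ : Ord → Ord → Set
α <ₒ β = cmp α β ≡ lt

_≤ₒ_ : Ord → Ord → Set
α ≤ₒ β = α <ₒ β ⊎ α ≡ β

data IsCNF : Ord → Set where
  cnf𝟎 : IsCNF 𝟎
  cnf1 : ∀ {a} → IsCNF a → IsCNF (ω^ a + 𝟎)
  cnf2 : ∀ {a c d} → IsCNF a → IsCNF (ω^ c + d) → c ≤ₒ a → IsCNF (ω^ a + (ω^ c + d))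

_⊕_ : Ord → Ord → Ord
𝟎 ⊕ β = β
(ω^ a + b) ⊕ 𝟎 = ω^ a + b
(ω^ a + b) ⊕ (ω^ c + d) with cmp a c
... | lt = ω^ c + d
... | eq = ω^ a + (b ⊕ (ω^ c + d))
... | gt = ω^ a + (b ⊕ (ω^ c + d))

ω^⟨_⟩ : Ord → Ord
ω^⟨ α ⟩ = ω^ α + 𝟎

𝟏 : Ord
𝟏 = ω^ 𝟎 + 𝟎

ω^_·_ : Ord → ℕ → Ord
ω^ δ · zero = 𝟎
ω^ δ · suc m = ω^ δ + (ω^ δ · m)

fin : ℕ → Ord
fin n = ω^ 𝟎 · n

ω·_+_ : ℕ → ℕ → Ord
ω· zero + q = fin q
ω· suc p + q = ω^ 𝟏 + (ω· p + q)

isSucc : Ord → Bool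
isSucc 𝟎 = false
isSucc (ω^ 𝟎 + 𝟎) = true
isSucc (ω^ (ω^ _ + _) + 𝟎) = false
isSucc (ω^ a + (ω^ c + d)) = isSucc (ω^ c + d)

fs : Ord → ℕ → Ord
fs 𝟎 n = 𝟎
fs (ω^ 𝟎 + 𝟎) n = 𝟎
fs (ω^ δ@(ω^ _ + _) + 𝟎) n =
  if isSucc δ then ω^ (fs δ n) · suc n            -- δ = δ'+1, δ' = {δ}(n)
              else ω^⟨ fs δ n ⟩
fs (ω^ a + b@(ω^ _ + _)) n = ω^ a + fs b n

lastExp : Ord → Ord → Ord
lastExp a 𝟎 = a
lastExp a (ω^ c + d) = lastExp c d

Meshes : Ord → Ord → Set
Meshes 𝟎 γ = ⊤
Meshes (ω^ a + b) γ = γ <ₒ ω^⟨ lastExp a b ⊕ 𝟏 ⟩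

data SD : Set where
  fund : ℕ → SD
  _⋆_  : SD → SD → SD
  _+ₛ_ : Ord → SD → SD
  ω^ₛ  : SD → SD

data HasTB : SD → Ord → Ord → Set where
  fundH : ∀ {β m} → IsCNF β → HasTB (fund m) β (fs β m)
  compH : ∀ {s t α β γ} → HasTB s β α → HasTB t γ β → HasTB (s ⋆ t) γ α
  addH  : ∀ {s α β γ} → IsCNF α → Meshes α γ → HasTB s γ β →
          HasTB (α +ₛ s) (α ⊕ γ) (α ⊕ β)
  expH  : ∀ {s α β} → HasTB s β α → HasTB (ω^ₛ s) ω^⟨ β ⟩ ω^⟨ α ⟩

base : SD → ℕ
base (fund m) = m
base (s ⋆ t) = base s ⊔ base t
base (α +ₛ s) = base s
base (ω^ₛ s) = base s

_⊢_≤[_]_ : SD → Ord → ℕ → Ord → Set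
s ⊢ α ≤[ k ] β = HasTB s β α × base s ≤ℕ k

module Submission where

-- Parts (a) and (b) are structural: (a) only weakens the bound on the base,
-- and (b) is an induction on the derivation of "s has top β and bottom α",
-- using {β}(m) < β, α ≤ α + γ, and monotonicity of addition (on the right)
-- and of ω^(-).
--
-- Part (c) is again an induction on the derivation, with the invariant
-- "Descends k β α": whenever β = ω·p+q and α = ω·p'+q', the pair (p',q') is
-- reached from (p,q) by a k-bounded descent (p' = p and q' ≤ q, or p' < p and
-- q' ≤ k+1).  Descents compose, which handles the composition rule.  The other
-- rules need that every Cantor normal form below ω² has the form ω·p+q (tops
-- and bottoms of derivations are normal forms, and bottoms lie below tops),
-- plus explicit computations of fundamental sequences, sums and meshing below
-- ω².

open import Defs
open import Data.Nat using (ℕ; zero; suc; _≤_; _<_; _+_; z≤n; s≤s)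
open import Data.Nat.Properties
  using (≤-trans; ≤-refl; n≤1+n; m≤m⊔n; m≤n⊔m; m≤n+m; +-monoʳ-≤; +-monoʳ-<;
         <-trans; +-identityʳ; +-comm)
open import Data.Product using (_×_; _,_; proj₁; proj₂; Σ)
open import Data.Sum using (_⊎_; inj₁; inj₂)
open import Data.Empty using (⊥; ⊥-elim)
open import Data.Unit using (⊤; tt)
open import Data.Bool using (true; false)
open import Relation.Binary.PropositionalEquality
  using (_≡_; _≢_; refl; sym; trans; cong; cong₂; subst)

cmp-refl : ∀ x → cmp x x ≡ eq
cmp-refl 𝟎 = refl
cmp-refl (ω^ a + b) rewrite cmp-refl a = cmp-refl b

cmp-eq⇒≡ : ∀ x y → cmp x y ≡ eq → x ≡ y
cmp-eq⇒≡ 𝟎 𝟎 _ = refl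
cmp-eq⇒≡ (ω^ a + b) (ω^ c + d) p with cmp a c in e
... | eq = cong₂ ω^_+_ (cmp-eq⇒≡ a c e) (cmp-eq⇒≡ b d p)

cmp-lead : ∀ {a b c d} → a <ₒ c → (ω^ a + b) <ₒ (ω^ c + d)
cmp-lead a<c rewrite a<c = refl

cmp-tail : ∀ {a b c d} → cmp a c ≡ eq → cmp (ω^ a + b) (ω^ c + d) ≡ cmp b d
cmp-tail a≡c rewrite a≡c = refl

<-ω^-inv : ∀ {a b c d} → (ω^ a + b) <ₒ (ω^ c + d) → a <ₒ c ⊎ (cmp a c ≡ eq × b <ₒ d)
<-ω^-inv {a} {b} {c} {d} p with cmp a c
... | lt = inj₁ refl
... | eq = inj₂ (refl , p)

cmp-flip : ∀ x y → cmp x y ≡ gt → y <ₒ x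
cmp-flip (ω^ _ + _) 𝟎 _ = refl
cmp-flip (ω^ a + b) (ω^ c + d) p with cmp a c in e
... | eq rewrite cmp-eq⇒≡ a c e | cmp-refl c = cmp-flip b d p
... | gt = cmp-lead {c} {d} {a} {b} (cmp-flip a c e)

≮𝟎 : ∀ x → x <ₒ 𝟎 → ⊥
≮𝟎 𝟎 ()
≮𝟎 (ω^ _ + _) ()

<ₒ-trans : ∀ x y z → x <ₒ y → y <ₒ z → x <ₒ z
<ₒ-trans x 𝟎 z p q = ⊥-elim (≮𝟎 x p)
<ₒ-trans 𝟎 (ω^ _ + _) (ω^ _ + _) p q = refl
<ₒ-trans (ω^ a + b) (ω^ c + d) (ω^ e + f) p q
  with <-ω^-inv {a} {b} {c} {d} p | <-ω^-inv {c} {d} {e} {f} q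
... | inj₁ a<c | inj₁ c<e = cmp-lead {a} {b} {e} {f} (<ₒ-trans a c e a<c c<e)
... | inj₁ a<c | inj₂ (c≡e , _) rewrite sym (cmp-eq⇒≡ c e c≡e) = cmp-lead {a} {b} {c} {f} a<c
... | inj₂ (a≡c , _) | inj₁ c<e rewrite cmp-eq⇒≡ a c a≡c = cmp-lead {c} {b} {e} {f} c<e
... | inj₂ (a≡c , b<d) | inj₂ (c≡e , d<f) rewrite cmp-eq⇒≡ a c a≡c | cmp-eq⇒≡ c e c≡e =
  trans (cmp-tail {e} {b} {e} {f} (cmp-refl e)) (<ₒ-trans b d f b<d d<f)

≤ₒ-trans : ∀ {x y z} → x ≤ₒ y → y ≤ₒ z → x ≤ₒ z
≤ₒ-trans {x} {y} {z} (inj₁ p) (inj₁ q) = inj₁ (<ₒ-trans x y z p q)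
≤ₒ-trans (inj₁ p) (inj₂ refl) = inj₁ p
≤ₒ-trans (inj₂ refl) q = q

≤<ₒ-trans : ∀ {x y z} → x ≤ₒ y → y <ₒ z → x <ₒ z
≤<ₒ-trans {x} {y} {z} (inj₁ p) q = <ₒ-trans x y z p q
≤<ₒ-trans (inj₂ refl) q = q

<≤ₒ-trans : ∀ {x y z} → x <ₒ y → y ≤ₒ z → x <ₒ z
<≤ₒ-trans {x} {y} {z} p (inj₁ q) = <ₒ-trans x y z p q
<≤ₒ-trans p (inj₂ refl) = p

lead-≤ : ∀ {a b c d} → (ω^ a + b) ≤ₒ (ω^ c + d) → a ≤ₒ c
lead-≤ {a} {b} {c} {d} (inj₁ p) with <-ω^-inv {a} {b} {c} {d} p
... | inj₁ a<c = inj₁ a<c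
... | inj₂ (a≡c , _) = inj₂ (cmp-eq⇒≡ a c a≡c)
lead-≤ (inj₂ refl) = inj₂ refl

tail-≤ : ∀ {a b c} → b ≤ₒ c → (ω^ a + b) ≤ₒ (ω^ a + c)
tail-≤ {a} {b} {c} (inj₁ p) = inj₁ (trans (cmp-tail {a} {b} {a} {c} (cmp-refl a)) p)
tail-≤ (inj₂ refl) = inj₂ refl

𝟎≤ : ∀ x → 𝟎 ≤ₒ x
𝟎≤ 𝟎 = inj₂ refl
𝟎≤ (ω^ _ + _) = inj₁ refl

lt≢eq : lt ≢ eq
lt≢eq ()

lt≢gt : lt ≢ gt
lt≢gt ()

⊕-𝟎 : ∀ x → x ⊕ 𝟎 ≡ x
⊕-𝟎 𝟎 = refl
⊕-𝟎 (ω^ _ + _) = refl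

≤-⊕ : ∀ α γ → α ≤ₒ (α ⊕ γ)
≤-⊕ 𝟎 γ = 𝟎≤ γ
≤-⊕ (ω^ a + b) 𝟎 = inj₂ refl
≤-⊕ (ω^ a + b) (ω^ c + d) with cmp a c in e
... | lt = inj₁ (cmp-lead {a} {b} {c} {d} e)
... | eq = tail-≤ (≤-⊕ b (ω^ c + d))
... | gt = tail-≤ (≤-⊕ b (ω^ c + d))

-- Addition is monotone in its right argument.  When ω^a is absorbed by the
-- larger argument ω^e+f but not by the smaller ω^c+d, the comparison is
-- decided by the leading exponents.
⊕-monoʳ : ∀ α {β γ} → β ≤ₒ γ → (α ⊕ β) ≤ₒ (α ⊕ γ)
⊕-monoʳ α (inj₂ refl) = inj₂ refl
⊕-monoʳ 𝟎 p = p
⊕-monoʳ (ω^ a + b) {𝟎} {γ} p = ≤-⊕ (ω^ a + b) γ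
⊕-monoʳ (ω^ a + b) {ω^ c + d} {ω^ e + f} p with cmp a c in ac | cmp a e in ae
... | lt | lt = p
... | lt | eq = ⊥-elim (lt≢eq (trans (sym (<≤ₒ-trans {a} ac (lead-≤ p))) ae))
... | lt | gt = ⊥-elim (lt≢gt (trans (sym (<≤ₒ-trans {a} ac (lead-≤ p))) ae))
... | eq | lt = inj₁ (cmp-lead {a} {b ⊕ (ω^ c + d)} {e} {f} ae)
... | gt | lt = inj₁ (cmp-lead {a} {b ⊕ (ω^ c + d)} {e} {f} ae)
... | eq | eq = tail-≤ (⊕-monoʳ b p)
... | eq | gt = tail-≤ (⊕-monoʳ b p)
... | gt | eq = tail-≤ (⊕-monoʳ b p)
... | gt | gt = tail-≤ (⊕-monoʳ b p)

LeadLe : Ord → Ord → Set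
LeadLe e 𝟎 = ⊤
LeadLe e (ω^ c + d) = c ≤ₒ e

cnf-mk : ∀ {a b} → IsCNF a → IsCNF b → LeadLe a b → IsCNF (ω^ a + b)
cnf-mk {b = 𝟎} ha _ _ = cnf1 ha
cnf-mk {b = ω^ c + d} ha hb le = cnf2 ha hb le

cnf-head : ∀ {a b} → IsCNF (ω^ a + b) → IsCNF a
cnf-head (cnf1 h) = h
cnf-head (cnf2 h _ _) = h

cnf-tail : ∀ {a b} → IsCNF (ω^ a + b) → IsCNF b
cnf-tail (cnf1 h) = cnf𝟎
cnf-tail (cnf2 _ h _) = h

cnf-lead : ∀ {a b} → IsCNF (ω^ a + b) → LeadLe a b
cnf-lead (cnf1 h) = tt
cnf-lead (cnf2 _ _ l) = l

LeadLe-weaken : ∀ {c e} x → LeadLe c x → c ≤ₒ e → LeadLe e x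
LeadLe-weaken 𝟎 _ _ = tt
LeadLe-weaken (ω^ _ + _) l c≤e = ≤ₒ-trans l c≤e

LeadLe-⊕ : ∀ {e} b γ → LeadLe e b → LeadLe e γ → LeadLe e (b ⊕ γ)
LeadLe-⊕ 𝟎 γ _ l = l
LeadLe-⊕ (ω^ a + b) 𝟎 l _ = l
LeadLe-⊕ (ω^ a + b) (ω^ c + d) l l′ with cmp a c
... | lt = l′
... | eq = l
... | gt = l

⊕-cnf : ∀ {α γ} → IsCNF α → IsCNF γ → IsCNF (α ⊕ γ)
⊕-cnf {𝟎} _ h = h
⊕-cnf {ω^ a + b} {𝟎} h _ = h
⊕-cnf {ω^ a + b} {ω^ c + d} hα hγ with cmp a c in e
... | lt = hγ
... | eq = cnf-mk (cnf-head hα) (⊕-cnf (cnf-tail hα) hγ)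
                  (LeadLe-⊕ b (ω^ c + d) (cnf-lead hα) (inj₂ (sym (cmp-eq⇒≡ a c e))))
... | gt = cnf-mk (cnf-head hα) (⊕-cnf (cnf-tail hα) hγ)
                  (LeadLe-⊕ b (ω^ c + d) (cnf-lead hα) (inj₁ (cmp-flip a c e)))

fs-< : ∀ a b n → fs (ω^ a + b) n <ₒ (ω^ a + b)
fs-< 𝟎 𝟎 n = refl
fs-< (ω^ c + d) 𝟎 n with isSucc (ω^ c + d)
... | true = cmp-lead {fs (ω^ c + d) n} {ω^ fs (ω^ c + d) n · n} {ω^ c + d} {𝟎} (fs-< c d n)
... | false = cmp-lead {fs (ω^ c + d) n} {𝟎} {ω^ c + d} {𝟎} (fs-< c d n)
fs-< 𝟎 (ω^ c + d) n =
  trans (cmp-tail {𝟎} {fs (ω^ c + d) n} {𝟎} {ω^ c + d} refl) (fs-< c d n)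
fs-< a@(ω^ _ + _) (ω^ c + d) n =
  trans (cmp-tail {a} {fs (ω^ c + d) n} {a} {ω^ c + d} (cmp-refl a)) (fs-< c d n)

fs-≤ : ∀ β m → fs β m ≤ₒ β
fs-≤ 𝟎 m = inj₂ refl
fs-≤ (ω^ a + b) m = inj₁ (fs-< a b m)

ω^·-cnf : ∀ {e} → IsCNF e → ∀ m → IsCNF (ω^ e · suc m)
ω^·-cnf h zero = cnf1 h
ω^·-cnf h (suc m) = cnf2 h (ω^·-cnf h m) (inj₂ refl)

LeadLe-fs : ∀ c d n → LeadLe c (fs (ω^ c + d) n)
LeadLe-fs 𝟎 𝟎 n = tt
LeadLe-fs (ω^ c + d) 𝟎 n with isSucc (ω^ c + d)
... | true = inj₁ (fs-< c d n)
... | false = inj₁ (fs-< c d n)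
LeadLe-fs 𝟎 (ω^ c + d) n = inj₂ refl
LeadLe-fs (ω^ _ + _) (ω^ c + d) n = inj₂ refl

fs-cnf : ∀ {β} n → IsCNF β → IsCNF (fs β n)
fs-cnf n cnf𝟎 = cnf𝟎
fs-cnf n (cnf1 {𝟎} h) = cnf𝟎
fs-cnf n (cnf1 {ω^ c + d} h) with isSucc (ω^ c + d)
... | true = ω^·-cnf (fs-cnf n h) n
... | false = cnf1 (fs-cnf n h)
fs-cnf n (cnf2 {𝟎} {c} {d} ha hb le) =
  cnf-mk ha (fs-cnf n hb) (LeadLe-weaken (fs (ω^ c + d) n) (LeadLe-fs c d n) le)
fs-cnf n (cnf2 {ω^ _ + _} {c} {d} ha hb le) =
  cnf-mk ha (fs-cnf n hb) (LeadLe-weaken (fs (ω^ c + d) n) (LeadLe-fs c d n) le)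

HasTB-cnf : ∀ {s β α} → HasTB s β α → IsCNF β × IsCNF α
HasTB-cnf (fundH {m = m} h) = h , fs-cnf m h
HasTB-cnf (compH p q) = proj₁ (HasTB-cnf q) , proj₂ (HasTB-cnf p)
HasTB-cnf (addH hα _ p) = ⊕-cnf hα (proj₁ (HasTB-cnf p)) , ⊕-cnf hα (proj₂ (HasTB-cnf p))
HasTB-cnf (expH p) = cnf1 (proj₁ (HasTB-cnf p)) , cnf1 (proj₂ (HasTB-cnf p))

bottom≤top : ∀ {s β α} → HasTB s β α → α ≤ₒ β
bottom≤top (fundH {β} {m} h) = fs-≤ β m
bottom≤top (compH p q) = ≤ₒ-trans (bottom≤top p) (bottom≤top q)
bottom≤top (addH {α = α} _ _ p) = ⊕-monoʳ α (bottom≤top p)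
bottom≤top (expH {α = α} {β} p) with bottom≤top p
... | inj₁ α<β = inj₁ (cmp-lead {α} {𝟎} {β} {𝟎} α<β)
... | inj₂ refl = inj₂ refl

-- Ordinals below ω²

ω² : Ord
ω² = ω^⟨ fin 2 ⟩

ω·+-< : ∀ p q → (ω· p + q) <ₒ ω²
ω·+-< zero zero = refl
ω·+-< zero (suc q) = refl
ω·+-< (suc p) q = refl

tail-≡ : ∀ {a b c d} → (ω^ a + b) ≡ (ω^ c + d) → b ≡ d
tail-≡ refl = refl

fin-injective : ∀ q q' → fin q ≡ fin q' → q ≡ q'
fin-injective zero zero _ = refl
fin-injective (suc q) (suc q') e = cong suc (fin-injective q q' (tail-≡ e))

ω·+-injective : ∀ p q p' q' → ω· p + q ≡ ω· p' + q' → p ≡ p' × q ≡ q'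
ω·+-injective zero q zero q' e = refl , fin-injective q q' e
ω·+-injective zero zero (suc p') q' ()
ω·+-injective zero (suc q) (suc p') q' ()
ω·+-injective (suc p) q zero zero ()
ω·+-injective (suc p) q zero (suc q') ()
ω·+-injective (suc p) q (suc p') q' e with ω·+-injective p q p' q' (tail-≡ e)
... | refl , q≡q' = refl , q≡q'

exponent<2 : ∀ a → a <ₒ fin 2 → a ≡ 𝟎 ⊎ a ≡ 𝟏
exponent<2 𝟎 _ = inj₁ refl
exponent<2 (ω^ 𝟎 + 𝟎) _ = inj₂ refl
exponent<2 (ω^ 𝟎 + (ω^ 𝟎 + 𝟎)) ()
exponent<2 (ω^ 𝟎 + (ω^ 𝟎 + (ω^ _ + _))) ()
exponent<2 (ω^ 𝟎 + (ω^ (ω^ _ + _) + _)) ()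
exponent<2 (ω^ (ω^ _ + _) + _) ()

1≰0 : 𝟏 ≤ₒ 𝟎 → ⊥
1≰0 (inj₁ ())
1≰0 (inj₂ ())

<ω²-shape : ∀ β → IsCNF β → β <ₒ ω² → Σ ℕ λ p → Σ ℕ λ q → β ≡ ω· p + q
<ω²-shape 𝟎 _ _ = 0 , 0 , refl
<ω²-shape (ω^ a + b) h β<ω² with <-ω^-inv {a} {b} {fin 2} {𝟎} β<ω²
... | inj₂ (_ , b<𝟎) = ⊥-elim (≮𝟎 b b<𝟎)
... | inj₁ a<2 with exponent<2 a a<2 | <ω²-shape b (cnf-tail h) (tail<ω² b (cnf-lead h) a<2)
  where
    tail<ω² : ∀ b → LeadLe a b → a <ₒ fin 2 → b <ₒ ω²
    tail<ω² 𝟎 _ _ = refl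
    tail<ω² (ω^ c + d) c≤a a<2 = cmp-lead {c} {d} {fin 2} {𝟎} (≤<ₒ-trans c≤a a<2)
... | inj₂ refl | p , q , refl = suc p , q , refl
... | inj₁ refl | zero , q , refl = 0 , suc q , refl
... | inj₁ refl | suc p , q , refl = ⊥-elim (1≰0 (cnf-lead h))

≤ω·+-shape : ∀ {β} p q → IsCNF β → β ≤ₒ (ω· p + q) → Σ ℕ λ p' → Σ ℕ λ q' → β ≡ ω· p' + q'
≤ω·+-shape {β} p q h β≤ = <ω²-shape β h (≤<ₒ-trans β≤ (ω·+-< p q))

<ω-finite : ∀ {γ} → IsCNF γ → γ <ₒ ω^⟨ 𝟏 ⟩ → Σ ℕ λ d → γ ≡ fin d
<ω-finite {γ} h γ<ω with <ω²-shape γ h (<ₒ-trans γ ω^⟨ 𝟏 ⟩ ω² γ<ω refl)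
... | zero , d , refl = d , refl
... | suc c , d , refl = ⊥-elim (≮𝟎 (ω· c + d) γ<ω)

fs-succ : ∀ p q m → fs (ω· p + suc q) m ≡ ω· p + q
fs-succ zero zero m = refl
fs-succ zero (suc q) m = cong (ω^ 𝟎 +_) (fs-succ zero q m)
fs-succ (suc zero) q m = cong (ω^ 𝟏 +_) (fs-succ zero q m)
fs-succ (suc (suc p)) q m = cong (ω^ 𝟏 +_) (fs-succ (suc p) q m)

fs-limit : ∀ p m → fs (ω· suc p + 0) m ≡ ω· p + suc m
fs-limit zero m = refl
fs-limit (suc p) m = cong (ω^ 𝟏 +_) (fs-limit p m)

fin-⊕ : ∀ b d → fin b ⊕ fin d ≡ fin (b + d)
fin-⊕ zero d = refl
fin-⊕ (suc b) zero = cong fin (sym (+-identityʳ (suc b)))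
fin-⊕ (suc b) (suc d) = cong (ω^ 𝟎 +_) (fin-⊕ b (suc d))

succ-⊕-fin : ∀ a b d → (ω· a + suc b) ⊕ fin d ≡ ω· a + (suc b + d)
succ-⊕-fin a b zero =
  trans (⊕-𝟎 (ω· a + suc b)) (cong (λ x → ω· a + x) (sym (+-identityʳ (suc b))))
succ-⊕-fin zero b (suc d) = fin-⊕ (suc b) (suc d)
succ-⊕-fin (suc a) b (suc d) = cong (ω^ 𝟏 +_) (succ-⊕-fin a b (suc d))

limit-⊕ : ∀ a c d → (ω· suc a + 0) ⊕ (ω· c + d) ≡ ω· (suc a + c) + d
limit-⊕ a zero zero =
  trans (⊕-𝟎 (ω· suc a + 0)) (cong (λ x → ω· x + 0) (sym (+-identityʳ (suc a))))
limit-⊕ zero zero (suc d) = refl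
limit-⊕ zero (suc c) d = refl
limit-⊕ (suc a) zero (suc d) = cong (ω^ 𝟏 +_) (limit-⊕ a zero (suc d))
limit-⊕ (suc a) (suc c) d = cong (ω^ 𝟏 +_) (limit-⊕ a (suc c) d)

lastExp-fin : ∀ b → lastExp 𝟎 (fin b) ≡ 𝟎
lastExp-fin zero = refl
lastExp-fin (suc b) = lastExp-fin b

lastExp-succ : ∀ e a b → lastExp e (ω· a + suc b) ≡ 𝟎
lastExp-succ e zero b = lastExp-fin b
lastExp-succ e (suc a) b = lastExp-succ 𝟏 a b

lastExp-limit : ∀ a → lastExp 𝟏 (ω· a + 0) ≡ 𝟏
lastExp-limit zero = refl
lastExp-limit (suc a) = lastExp-limit a

meshes-succ : ∀ a b γ → Meshes (ω· a + suc b) γ → γ <ₒ ω^⟨ 𝟏 ⟩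
meshes-succ zero b γ m = subst (λ e → γ <ₒ ω^⟨ e ⊕ 𝟏 ⟩) (lastExp-fin b) m
meshes-succ (suc a) b γ m = subst (λ e → γ <ₒ ω^⟨ e ⊕ 𝟏 ⟩) (lastExp-succ 𝟏 a b) m

meshes-limit : ∀ a γ → Meshes (ω· suc a + 0) γ → γ <ₒ ω²
meshes-limit a γ m = subst (λ e → γ <ₒ ω^⟨ e ⊕ 𝟏 ⟩) (lastExp-limit a) m

ω^-shape : ∀ x p q → ω^⟨ x ⟩ ≡ ω· p + q →
           (x ≡ 𝟎 × p ≡ 0 × q ≡ 1) ⊎ (x ≡ 𝟏 × p ≡ 1 × q ≡ 0)
ω^-shape x zero (suc zero) refl = inj₁ (refl , refl , refl)
ω^-shape x zero (suc (suc q)) ()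
ω^-shape x (suc zero) zero refl = inj₂ (refl , refl , refl)
ω^-shape x (suc zero) (suc q) ()
ω^-shape x (suc (suc p)) q ()

-- Bounded descents

data Descent (k : ℕ) : ℕ × ℕ → ℕ × ℕ → Set where
  same-ω  : ∀ {p q q'} → q' ≤ q → Descent k (p , q) (p , q')
  fewer-ω : ∀ {p q p' q'} → p' < p → q' ≤ k + 1 → Descent k (p , q) (p' , q')

Descent-trans : ∀ {k x y z} → Descent k x y → Descent k y z → Descent k x z
Descent-trans (same-ω q₁≤q) (same-ω q'≤q₁) = same-ω (≤-trans q'≤q₁ q₁≤q)
Descent-trans (same-ω _) (fewer-ω p'<p q'≤) = fewer-ω p'<p q'≤
Descent-trans (fewer-ω p₁<p q₁≤) (same-ω q'≤q₁) = fewer-ω p₁<p (≤-trans q'≤q₁ q₁≤)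
Descent-trans (fewer-ω p₁<p _) (fewer-ω p'<p₁ q'≤) = fewer-ω (<-trans p'<p₁ p₁<p) q'≤

Descent-shift : ∀ {k p q p' q'} n → Descent k (p , q) (p' , q') → Descent k (n + p , q) (n + p' , q')
Descent-shift n (same-ω q'≤q) = same-ω q'≤q
Descent-shift n (fewer-ω p'<p q'≤) = fewer-ω (+-monoʳ-< n p'<p) q'≤

Descent-transport : ∀ {k} p₀ q₀ p₀' q₀' {p q p' q'} → Descent k (p₀ , q₀) (p₀' , q₀') →
                    ω· p₀ + q₀ ≡ ω· p + q → ω· p₀' + q₀' ≡ ω· p' + q' →
                    Descent k (p , q) (p' , q')
Descent-transport p₀ q₀ p₀' q₀' {p} {q} {p'} {q'} d eT eB
  with ω·+-injective p₀ q₀ p q eT | ω·+-injective p₀' q₀' p' q' eB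
... | refl , refl | refl , refl = d

Descends : ℕ → Ord → Ord → Set
Descends k β α = ∀ {p q p' q'} → β ≡ ω· p + q → α ≡ ω· p' + q' → Descent k (p , q) (p' , q')

-- A fundamental-sequence step {β}(m) with m ≤ k: below ω² it either lowers
-- the finite part by one, or replaces ω·(p+1) by ω·p + (m+1).
fund-descends : ∀ {k m} β → m ≤ k → Descends k β (fs β m)
fund-descends _ _ {zero} {zero} refl eB = Descent-transport 0 0 0 0 (same-ω z≤n) refl eB
fund-descends {m = m} _ _ {p} {suc q} refl eB =
  Descent-transport p (suc q) p q (same-ω (n≤1+n q)) refl (trans (sym (fs-succ p q m)) eB)
fund-descends {k} {m} _ m≤k {suc p} {zero} refl eB =
  Descent-transport (suc p) 0 p (suc m) (fewer-ω ≤-refl (subst (suc m ≤_) (+-comm 1 k) (s≤s m≤k)))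
                    refl (trans (sym (fs-limit p m)) eB)

-- Composition: the middle ordinal is a normal form below the top, hence of
-- the form ω·p+q, and descents compose.
comp-descends : ∀ {k γ β α} → IsCNF β → β ≤ₒ γ →
                Descends k β α → Descends k γ β → Descends k γ α
comp-descends {β = β} hβ β≤γ lower upper {p} {q} eT eB
  with ≤ω·+-shape p q hβ (subst (β ≤ₒ_) eT β≤γ)
... | p₁ , q₁ , eM = Descent-trans (upper {p' = p₁} {q₁} eT eM) (lower eM eB)

-- Adding a successor ω·a+(b+1) in front: by meshing the step happens below ω,
-- so it only lowers the finite part.
succ-add-descends : ∀ {k} a b {γ β} → IsCNF γ → IsCNF β → β ≤ₒ γ →
                    Meshes (ω· a + suc b) γ → Descends k γ β →
                    Descends k ((ω· a + suc b) ⊕ γ) ((ω· a + suc b) ⊕ β)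
succ-add-descends a b {γ} hγ hβ β≤γ mesh step eT eB
  with <ω-finite hγ (meshes-succ a b γ mesh)
     | <ω-finite hβ (≤<ₒ-trans β≤γ (meshes-succ a b γ mesh))
... | d , refl | d' , refl with step {0} {d} {0} {d'} refl refl
... | same-ω d'≤d =
  Descent-transport a (suc b + d) a (suc b + d') (same-ω (+-monoʳ-≤ (suc b) d'≤d))
                    (trans (sym (succ-⊕-fin a b d)) eT) (trans (sym (succ-⊕-fin a b d')) eB)

-- Adding a limit ω·(a+1) in front shifts the step by ω·(a+1).
limit-add-descends : ∀ {k} a {γ β} → IsCNF γ → IsCNF β → β ≤ₒ γ →
                     Meshes (ω· suc a + 0) γ → Descends k γ β →
                     Descends k ((ω· suc a + 0) ⊕ γ) ((ω· suc a + 0) ⊕ β)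
limit-add-descends a {γ} hγ hβ β≤γ mesh step eT eB
  with <ω²-shape γ hγ (meshes-limit a γ mesh)
... | c , d , refl with ≤ω·+-shape c d hβ β≤γ
... | c' , d' , refl =
  Descent-transport (suc a + c) d (suc a + c') d' (Descent-shift (suc a) (step refl refl))
                    (trans (sym (limit-⊕ a c d)) eT) (trans (sym (limit-⊕ a c' d')) eB)

-- The addition rule: the summand α lies below the top, so it is 0, a
-- successor ω·a+(b+1) or a limit ω·(a+1).
add-descends : ∀ {k α γ β} → IsCNF α → IsCNF γ → IsCNF β → β ≤ₒ γ → Meshes α γ →
               Descends k γ β → Descends k (α ⊕ γ) (α ⊕ β)
add-descends {α = α} {γ} hα hγ hβ β≤γ mesh step {p} {q} eT eB
  with ≤ω·+-shape p q hα (subst (α ≤ₒ_) eT (≤-⊕ α γ))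
... | zero , zero , refl = step eT eB
... | a , suc b , refl = succ-add-descends a b hγ hβ β≤γ mesh step eT eB
... | suc a , zero , refl = limit-add-descends a hγ hβ β≤γ mesh step eT eB

-- The exponential rule: below ω² it can only relate 1 and ω.
ω^-descends : ∀ {k β α} → α ≤ₒ β → Descends k ω^⟨ β ⟩ ω^⟨ α ⟩
ω^-descends {k} {β} {α} α≤β {p} {q} {p'} {q'} eT eB
  with ω^-shape β p q eT | ω^-shape α p' q' eB
... | inj₁ (refl , refl , refl) | inj₁ (refl , refl , refl) = same-ω ≤-refl
... | inj₁ (refl , refl , refl) | inj₂ (refl , refl , refl) = ⊥-elim (1≰0 α≤β)
... | inj₂ (refl , refl , refl) | inj₁ (refl , refl , refl) = fewer-ω ≤-refl (m≤n+m 1 k)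
... | inj₂ (refl , refl , refl) | inj₂ (refl , refl , refl) = same-ω z≤n

descends : ∀ {s β α k} → HasTB s β α → base s ≤ k → Descends k β α
descends (fundH {β} _) m≤k = fund-descends β m≤k
descends (compH {s} {t} hs ht) base≤k =
  comp-descends (proj₂ (HasTB-cnf ht)) (bottom≤top ht)
    (descends hs (≤-trans (m≤m⊔n (base s) (base t)) base≤k))
    (descends ht (≤-trans (m≤n⊔m (base s) (base t)) base≤k))
descends (addH hα mesh hs) base≤k =
  add-descends hα (proj₁ (HasTB-cnf hs)) (proj₂ (HasTB-cnf hs)) (bottom≤top hs) mesh
    (descends hs base≤k)
descends (expH hs) _ = ω^-descends (bottom≤top hs)

Descent⇒cases : ∀ {k p q p' q'} → Descent k (p , q) (p' , q') →
                (p' ≡ p × q' ≤ q) ⊎ (p' < p × q' ≤ k + 1)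
Descent⇒cases (same-ω q'≤q) = inj₁ (refl , q'≤q)
Descent⇒cases (fewer-ω p'<p q'≤) = inj₂ (p'<p , q'≤)

lemma2p2 :
    (∀ (s : SD) (α β : Ord) (k k' : ℕ) → s ⊢ α ≤[ k ] β → k ≤ k' → s ⊢ α ≤[ k' ] β)
    × (∀ (s : SD) (α β : Ord) → HasTB s β α → α ≤ₒ β)
    × (∀ (s : SD) (p q p' q' k : ℕ) → HasTB s (ω· p + q) (ω· p' + q') → base s ≤ k →
         (p' ≡ p × q' ≤ q) ⊎ (p' < p × q' ≤ k + 1))
lemma2p2 = (λ s α β k k' (h , base≤k) k≤k' → h , ≤-trans base≤k k≤k')
         , (λ s α β h → bottom≤top h)
         , (λ s p q p' q' k h base≤k → Descent⇒cases (descends h base≤k refl refl))
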